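{- Let $A$ be an $iH^{\triangle}_3$-algebra, $H\subseteq A$ and $a\in A$. Then: (i) $[H)_m=\{x\in A:\ \text{there exist } h_1,\dots,h_k\in H \text{ with } (\triangle h_1,\dots,\triangle h_k;x)=1\}$; (ii) $[a)_m=[\triangle a)$, where $[b)$ denotes the deductive system generated by $\{b\}$; (iii) $[H\cup\{a\})_m=\{x\in A:\triangle a\to x\in[H)_m\}$.
   Context: An $iH^{\triangle}_3$-algebra is $(A,\to,\wedge,\triangle,1)$ such that $x\to(y\to x)=1$, $(x\to(y\to z))\to((x\to y)\to(x\to z))=1$, ($x\to y=1=y\to x$ implies $x=y$), $((x\to y)\to z)\to(((z\to x)\to z)\to z)=1$, $x\wedge(y\wedge z)=(x\wedge y)\wedge z$, $x\wedge x=x$, $x\wedge(x\to y)=x\wedge y$, $(x\to(y\wedge z))\to((x\to z)\wedge(x\to y))=1$, $\triangle x\to x=1$, $((y\to\triangle y)\to(x\to\triangle\triangle x))\to\triangle(x\to y)=\triangle x\to\triangle\triangle y$, and $(\triangle x\to\triangle y)\to\triangle x=\triangle x$. A deductive system is $D\subseteq A$ with $1\in D$ and ($x,x\to y\in D\Rightarrow y\in D$); it is modal if moreover $x\in D\Rightarrow\triangle x\in D$. $[H)$ (resp. $[H)_m$) is the intersection of all deductive systems (resp. modal deductive systems) containing $H$. Notation: $(x_1;x_1)$... precisely, $(x_1,\dots,x_{n-1};x_n)=x_n$ if $n=1$ and $=x_1\to(x_2,\dots,x_{n-1};x_n)$ if $n>1$, so $(\triangle h_1,\dots,\triangle h_k;x)=\triangle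 h_1\to(\triangle h_2\to\cdots(\triangle h_k\to x)\cdots)$. -}

module Defs where

open import Level using (Level; suc; _⊔_)
open import Data.List using (List; []; _∷_; foldr; map)
open import Data.List.Relation.Unary.All using (All)
open import Data.Product using (Σ; _×_; ∃)
open import Data.Sum using (_⊎_)
open import Relation.Binary.PropositionalEquality using (_≡_)

record IH3 : Set₁ where
  infixr 5 _⇒_
  field
    Carrier : Set
    _⇒_ : Carrier → Carrier → Carrier
    _∧_ : Carrier → Carrier → Carrier
    △ : Carrier → Carrier
    one : Carrier
    ax1 : ∀ x y → x ⇒ (y ⇒ x) ≡ one
    ax2 : ∀ x y z → (x ⇒ (y ⇒ z)) ⇒ ((x ⇒ y) ⇒ (x ⇒ z)) ≡ one
    ax3 : ∀ x y → x ⇒ y ≡ one → y ⇒ x ≡ one → x ≡ y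
    ax4 : ∀ x y z → ((x ⇒ y) ⇒ z) ⇒ (((z ⇒ x) ⇒ z) ⇒ z) ≡ one
    ax5 : ∀ x y z → x ∧ (y ∧ z) ≡ (x ∧ y) ∧ z
    ax6 : ∀ x → x ∧ x ≡ x
    ax7 : ∀ x y → x ∧ (x ⇒ y) ≡ x ∧ y
    ax8 : ∀ x y z → (x ⇒ (y ∧ z)) ⇒ ((x ⇒ z) ∧ (x ⇒ y)) ≡ one
    ax9 : ∀ x → △ x ⇒ x ≡ one
    ax10 : ∀ x y → ((y ⇒ △ y) ⇒ (x ⇒ △ (△ x))) ⇒ △ (x ⇒ y) ≡ △ x ⇒ △ (△ y)
    ax11 : ∀ x y → (△ x ⇒ △ y) ⇒ △ x ≡ △ x

module _ (𝔸 : IH3) where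
  open IH3 𝔸

  Subset : Set₁
  Subset = Carrier → Set

  _⊆_ : Subset → Subset → Set
  S ⊆ T = ∀ x → S x → T x

  record IsDS (D : Subset) : Set where
    field
      one∈ : D one
      mp : ∀ x y → D x → D (x ⇒ y) → D y

  record IsModalDS (D : Subset) : Set where
    field
      isDS : IsDS D
      △∈ : ∀ x → D x → D (△ x)

  GenDS : Subset → Carrier → Set₁
  GenDS H x = ∀ (D : Subset) → IsDS D → H ⊆ D → D x

  GenMDS : Subset → Carrier → Set₁
  GenMDS H x = ∀ (D : Subset) → IsModalDS D → H ⊆ D → D x

  -- (x_1, ..., x_{n-1}; x_n) with x_1..x_{n-1} given as a list
  chain : List Carrier → Carrier → Carrier
  chain hs x = foldr _⇒_ x hs

  △chain : List Carrier → Carrier → Carrier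
  △chain hs x = chain (map △ hs) x

  singleton : Carrier → Subset
  singleton a x = x ≡ a

  _∪_ : Subset → Subset → Subset
  (S ∪ T) x = S x ⊎ T x

-- Write x ≤ y for x ⇒ y = 1. The elements x with (△h₁, …, △hₖ; x) = 1 for
-- some hᵢ ∈ H form a modal deductive system containing H: modus ponens
-- concatenates the witnessing lists, and △ is pushed through a chain using
-- △1 = 1, △△x = △x and the K-law △(x ⇒ y) ≤ △x ⇒ △y. Any modal deductive
-- system containing H contains every △hᵢ and hence detaches x from such a
-- chain, which proves (i). For (ii), the up-set of △a is a modal deductive
-- system containing a and is contained in [△a), while every modal deductive
-- system containing a contains △a. For (iii), every occurrence of △a in a
-- chain over H ∪ {a} can be exchanged to the front and contracted, leaving a
-- chain over H ending in △a ⇒ x.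
module Submission where

open import Defs
open import Data.List using (List; []; _∷_; _++_; map)
open import Data.List.Properties using (map-++; foldr-++)
open import Data.List.Relation.Unary.All using (All; []; _∷_)
import Data.List.Relation.Unary.All as All
open import Data.List.Relation.Unary.All.Properties using (++⁺; map⁺)
open import Data.Product using (Σ; _×_; _,_)
open import Data.Sum using (inj₁; inj₂)
open import Function.Bundles using (_⇔_; mk⇔)
import Function.Properties.Equivalence as ⇔
open import Relation.Binary.PropositionalEquality
  using (_≡_; refl; sym; trans; cong; cong₂; subst)

module _ (𝔸 : IH3) where
  open IH3 𝔸

  infix 4 _≤_

  _≤_ : Carrier → Carrier → Set
  x ≤ y = x ⇒ y ≡ one

  one≤⇒≡one : ∀ {y} → one ≤ y → y ≡ one
  one≤⇒≡one {y} one≤y =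
    sym (ax3 one y one≤y (subst (λ t → y ⇒ t ≡ one) one≤y (ax1 y one)))

  modus-ponens : ∀ {x y} → x ≡ one → x ≤ y → y ≡ one
  modus-ponens refl = one≤⇒≡one

  ≤-refl : ∀ x → x ≤ x
  ≤-refl x = modus-ponens (ax1 x x) (modus-ponens (ax1 x (x ⇒ x)) (ax2 x (x ⇒ x) x))

  ≤-reflexive : ∀ {x y} → x ≡ y → x ≤ y
  ≤-reflexive {x} refl = ≤-refl x

  ≤-one : ∀ x → x ≤ one
  ≤-one x = one≤⇒≡one (ax1 one x)

  ≤-trans : ∀ {x y z} → x ≤ y → y ≤ z → x ≤ z
  ≤-trans {x} {y} {z} x≤y y≤z =
    modus-ponens x≤y (modus-ponens (modus-ponens y≤z (ax1 (y ⇒ z) x)) (ax2 x y z))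

  one⇒-identity : ∀ x → one ⇒ x ≡ x
  one⇒-identity x = ax3 (one ⇒ x) x
    (modus-ponens (≤-one (one ⇒ x)) (modus-ponens (≤-refl (one ⇒ x)) (ax2 (one ⇒ x) one x)))
    (ax1 x one)

  ⇒-monoʳ-≤ : ∀ {x y} z → x ≤ y → z ⇒ x ≤ z ⇒ y
  ⇒-monoʳ-≤ {x} {y} z x≤y = modus-ponens (modus-ponens x≤y (ax1 (x ⇒ y) z)) (ax2 z x y)

  ⇒-antiˡ-≤ : ∀ {x y} z → x ≤ y → y ⇒ z ≤ x ⇒ z
  ⇒-antiˡ-≤ {x} {y} z x≤y = ≤-trans (ax1 (y ⇒ z) x) x⇒y⇒z≤x⇒z
    where
    x⇒y⇒z≤x⇒z : x ⇒ (y ⇒ z) ≤ x ⇒ z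
    x⇒y⇒z≤x⇒z = subst (x ⇒ (y ⇒ z) ≤_) (one⇒-identity (x ⇒ z))
      (subst (λ t → x ⇒ (y ⇒ z) ≤ t ⇒ (x ⇒ z)) x≤y (ax2 x y z))

  ⇒-exchange : ∀ x y z → x ⇒ (y ⇒ z) ≤ y ⇒ (x ⇒ z)
  ⇒-exchange x y z = ≤-trans (ax2 x y z) (⇒-antiˡ-≤ (x ⇒ z) (ax1 y x))

  ⇒-contract : ∀ x y → x ⇒ (x ⇒ y) ≤ x ⇒ y
  ⇒-contract x y = ≤-trans (ax2 x x y)
    (≤-reflexive (trans (cong (_⇒ (x ⇒ y)) (≤-refl x)) (one⇒-identity (x ⇒ y))))

  △-one : △ one ≡ one
  △-one = one≤⇒≡one one≤t
    where
    t : Carrier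
    t = △ one
    -- ax11 and ax10 at x = y = 1 give t = t ⇒ △t, so 1 = t ⇒ t ≤ t by contraction.
    t≡t⇒△t : t ≡ t ⇒ △ t
    t≡t⇒△t = trans (sym (ax11 one t))
      (trans (cong₂ _⇒_ (cong₂ _⇒_ (sym (one⇒-identity t)) (sym (one⇒-identity (△ t))))
                        (cong △ (sym (≤-refl one))))
             (ax10 one one))
    one≤t : one ≤ t
    one≤t = ≤-trans (≤-reflexive (sym (≤-refl t)))
      (≤-trans (≤-reflexive (cong (t ⇒_) t≡t⇒△t))
        (≤-trans (⇒-contract t (△ t)) (≤-reflexive (sym t≡t⇒△t))))

  △≤△△ : ∀ x → △ x ≤ △ (△ x)
  △≤△△ x = trans (sym (ax10 x x))
    (trans (cong (Q ⇒_) (trans (cong △ (≤-refl x)) △-one)) (≤-one Q))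
    where
    Q : Carrier
    Q = (x ⇒ △ x) ⇒ (x ⇒ △ (△ x))

  △-idem : ∀ x → △ (△ x) ≡ △ x
  △-idem x = ax3 (△ (△ x)) (△ x) (ax9 (△ x)) (△≤△△ x)

  △-⇒-distrib : ∀ x y → △ (x ⇒ y) ≤ △ x ⇒ △ y
  △-⇒-distrib x y = subst (△ (x ⇒ y) ≤_)
    (trans (ax10 x y) (cong (△ x ⇒_) (△-idem y)))
    (ax1 (△ (x ⇒ y)) ((y ⇒ △ y) ⇒ (x ⇒ △ (△ x))))

  chain-monoʳ-≤ : ∀ cs {x y} → x ≤ y → chain 𝔸 cs x ≤ chain 𝔸 cs y
  chain-monoʳ-≤ []       x≤y = x≤y
  chain-monoʳ-≤ (c ∷ cs) x≤y = ⇒-monoʳ-≤ c (chain-monoʳ-≤ cs x≤y)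

  chain-one : ∀ cs → chain 𝔸 cs one ≡ one
  chain-one []       = refl
  chain-one (c ∷ cs) = trans (cong (c ⇒_) (chain-one cs)) (≤-one c)

  ≤-chain : ∀ cs x → x ≤ chain 𝔸 cs x
  ≤-chain []       x = ≤-refl x
  ≤-chain (c ∷ cs) x = ≤-trans (≤-chain cs x) (ax1 (chain 𝔸 cs x) c)

  chain-⇒-distrib : ∀ cs x y → chain 𝔸 cs (x ⇒ y) ≤ chain 𝔸 cs x ⇒ chain 𝔸 cs y
  chain-⇒-distrib []       x y = ≤-refl (x ⇒ y)
  chain-⇒-distrib (c ∷ cs) x y = ≤-trans (⇒-monoʳ-≤ c (chain-⇒-distrib cs x y)) (ax2 c _ _)

  chain-mp : ∀ cs {x y} → chain 𝔸 cs x ≡ one → chain 𝔸 cs (x ⇒ y) ≡ one → chain 𝔸 cs y ≡ one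
  chain-mp cs {x} {y} ⊢x ⊢x⇒y = modus-ponens ⊢x (modus-ponens ⊢x⇒y (chain-⇒-distrib cs x y))

  chain-absorb : ∀ p cs x → p ⇒ chain 𝔸 cs (p ⇒ x) ≤ chain 𝔸 cs (p ⇒ x)
  chain-absorb p []       x = ⇒-contract p x
  chain-absorb p (c ∷ cs) x = ≤-trans (⇒-exchange p c _) (⇒-monoʳ-≤ c (chain-absorb p cs x))

  △chain-++ : ∀ cs ds x → △chain 𝔸 (cs ++ ds) x ≡ △chain 𝔸 cs (△chain 𝔸 ds x)
  △chain-++ cs ds x = trans (cong (λ l → chain 𝔸 l x) (map-++ △ cs ds))
                            (foldr-++ _⇒_ x (map △ cs) (map △ ds))

  △-△chain : ∀ hs x → △ (△chain 𝔸 hs x) ≤ △chain 𝔸 hs (△ x)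
  △-△chain []       x = ≤-refl (△ x)
  △-△chain (h ∷ hs) x = ≤-trans (△-⇒-distrib (△ h) (△chain 𝔸 hs x))
    (≤-trans (≤-reflexive (cong (_⇒ △ (△chain 𝔸 hs x)) (△-idem h)))
             (⇒-monoʳ-≤ (△ h) (△-△chain hs x)))

  IsDS-chain-detach : ∀ {D} → IsDS 𝔸 D → ∀ cs x → All D cs → D (chain 𝔸 cs x) → D x
  IsDS-chain-detach isDS []       x []          Dx = Dx
  IsDS-chain-detach isDS (c ∷ cs) x (Dc ∷ Dcs) Dc⇒ =
    IsDS-chain-detach isDS cs x Dcs (IsDS.mp isDS c (chain 𝔸 cs x) Dc Dc⇒)

  IsDS-≡one : ∀ {D} → IsDS 𝔸 D → ∀ {x} → x ≡ one → D x
  IsDS-≡one {D} isDS x≡one = subst D (sym x≡one) (IsDS.one∈ isDS)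

  △Derivable : Subset 𝔸 → Subset 𝔸
  △Derivable H x = Σ (List Carrier) (λ hs → All H hs × △chain 𝔸 hs x ≡ one)

  △Derivable-isModalDS : ∀ H → IsModalDS 𝔸 (△Derivable H)
  △Derivable-isModalDS H = record
    { isDS = record { one∈ = [] , [] , refl ; mp = mp }
    ; △∈   = △∈
    }
    where
    mp : ∀ x y → △Derivable H x → △Derivable H (x ⇒ y) → △Derivable H y
    mp x y (cs , Hcs , ⊢x) (ds , Hds , ⊢x⇒y) =
      ds ++ cs , ++⁺ Hds Hcs , chain-mp (map △ (ds ++ cs)) ⊢ds++cs⊢x ⊢ds++cs⊢x⇒y
      where
      ⊢ds++cs⊢x : △chain 𝔸 (ds ++ cs) x ≡ one
      ⊢ds++cs⊢x = trans (△chain-++ ds cs x) (trans (cong (△chain 𝔸 ds) ⊢x) (chain-one (map △ ds)))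
      ⊢ds++cs⊢x⇒y : △chain 𝔸 (ds ++ cs) (x ⇒ y) ≡ one
      ⊢ds++cs⊢x⇒y = trans (△chain-++ ds cs (x ⇒ y))
        (modus-ponens ⊢x⇒y (chain-monoʳ-≤ (map △ ds) (≤-chain (map △ cs) (x ⇒ y))))
    △∈ : ∀ x → △Derivable H x → △Derivable H (△ x)
    △∈ x (hs , Hhs , ⊢x) =
      hs , Hhs , modus-ponens (trans (cong △ ⊢x) △-one) (△-△chain hs x)

  GenMDS⇔△Derivable : ∀ H x → GenMDS 𝔸 H x ⇔ △Derivable H x
  GenMDS⇔△Derivable H x = mk⇔
    (λ gen → gen (△Derivable H) (△Derivable-isModalDS H) (λ h Hh → h ∷ [] , Hh ∷ [] , ax9 h))
    (λ { (hs , Hhs , ⊢x) D isMDS H⊆D →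
         let isDS = IsModalDS.isDS isMDS
         in IsDS-chain-detach isDS (map △ hs) x
              (map⁺ (All.map (λ {h} Hh → IsModalDS.△∈ isMDS h (H⊆D h Hh)) Hhs))
              (IsDS-≡one isDS ⊢x) })

  Above : Carrier → Subset 𝔸
  Above b y = b ≤ y

  Above-isDS : ∀ b → IsDS 𝔸 (Above b)
  Above-isDS b = record { one∈ = ≤-one b ; mp = λ y z → chain-mp (b ∷ []) }

  Above△-isModalDS : ∀ a → IsModalDS 𝔸 (Above (△ a))
  Above△-isModalDS a = record
    { isDS = Above-isDS (△ a)
    ; △∈   = λ y △a≤y → subst (_≤ △ y) (△-idem a)
               (modus-ponens (trans (cong △ △a≤y) △-one) (△-⇒-distrib (△ a) y))
    }

  GenMDS-singleton⇔GenDS-△ : ∀ a x → GenMDS 𝔸 (singleton 𝔸 a) x ⇔ GenDS 𝔸 (singleton 𝔸 (△ a)) x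
  GenMDS-singleton⇔GenDS-△ a x = mk⇔ to from
    where
    to : GenMDS 𝔸 (singleton 𝔸 a) x → GenDS 𝔸 (singleton 𝔸 (△ a)) x
    to gen D isDS △a∈D = IsDS.mp isDS (△ a) x (△a∈D (△ a) refl) (IsDS-≡one isDS △a≤x)
      where
      △a≤x : △ a ≤ x
      △a≤x = gen (Above (△ a)) (Above△-isModalDS a) (λ { _ refl → ax9 a })
    from : GenDS 𝔸 (singleton 𝔸 (△ a)) x → GenMDS 𝔸 (singleton 𝔸 a) x
    from gen D isMDS a∈D = gen D (IsModalDS.isDS isMDS)
      (λ { _ refl → IsModalDS.△∈ isMDS a (a∈D a refl) })

  △chain-∪-singleton : ∀ H a x hs → All (_∪_ 𝔸 H (singleton 𝔸 a)) hs →
    Σ (List Carrier) (λ hs′ → All H hs′ × △chain 𝔸 hs x ≤ △chain 𝔸 hs′ (△ a ⇒ x))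
  △chain-∪-singleton H a x [] [] = [] , [] , ax1 x (△ a)
  △chain-∪-singleton H a x (h ∷ hs) (inj₁ Hh ∷ rest)
    with hs′ , Hhs′ , le ← △chain-∪-singleton H a x hs rest
    = h ∷ hs′ , Hh ∷ Hhs′ , ⇒-monoʳ-≤ (△ h) le
  △chain-∪-singleton H a x (h ∷ hs) (inj₂ refl ∷ rest)
    with hs′ , Hhs′ , le ← △chain-∪-singleton H a x hs rest
    = hs′ , Hhs′ , ≤-trans (⇒-monoʳ-≤ (△ a) le) (chain-absorb (△ a) (map △ hs′) x)

  △Derivable-∪-singleton⇔ : ∀ H a x →
    △Derivable (_∪_ 𝔸 H (singleton 𝔸 a)) x ⇔ △Derivable H (△ a ⇒ x)
  △Derivable-∪-singleton⇔ H a x = mk⇔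
    (λ (hs , Hahs , ⊢x) → let hs′ , Hhs′ , le = △chain-∪-singleton H a x hs Hahs
                          in hs′ , Hhs′ , modus-ponens ⊢x le)
    (λ (hs , Hhs , ⊢△a⇒x) → hs ++ a ∷ [] , ++⁺ (All.map inj₁ Hhs) (inj₂ refl ∷ [])
                           , trans (△chain-++ hs (a ∷ []) x) ⊢△a⇒x)

mainTheorem14 : (𝔸 : IH3) → (H : IH3.Carrier 𝔸 → Set) → (a : IH3.Carrier 𝔸) →
    ((x : IH3.Carrier 𝔸) → GenMDS 𝔸 H x ⇔ Σ (List (IH3.Carrier 𝔸)) (λ hs → All H hs × △chain 𝔸 hs x ≡ IH3.one 𝔸))
    × ((x : IH3.Carrier 𝔸) → GenMDS 𝔸 (singleton 𝔸 a) x ⇔ GenDS 𝔸 (singleton 𝔸 (IH3.△ 𝔸 a)) x)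
    × ((x : IH3.Carrier 𝔸) → GenMDS 𝔸 (_∪_ 𝔸 H (singleton 𝔸 a)) x ⇔ GenMDS 𝔸 H (IH3._⇒_ 𝔸 (IH3.△ 𝔸 a) x))
mainTheorem14 𝔸 H a =
    GenMDS⇔△Derivable 𝔸 H
  , GenMDS-singleton⇔GenDS-△ 𝔸 a
  , λ x → ⇔.trans (GenMDS⇔△Derivable 𝔸 (_∪_ 𝔸 H (singleton 𝔸 a)) x)
           (⇔.trans (△Derivable-∪-singleton⇔ 𝔸 H a x)
                    (⇔.sym (GenMDS⇔△Derivable 𝔸 H (IH3._⇒_ 𝔸 (IH3.△ 𝔸 a) x))))
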